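{- For all $m\ge 4$, \[ \gamma^{\mathrm{SID}}(K_m\times P_n)=\begin{cases}2m+3,& n=3,\\ 2m+6,& n=4.\end{cases} \]
   Context: For a vertex $v$, $N[v]$ is its closed neighborhood. A nonempty set $S\subseteq V(G)$ is a self-identifying code of $G$ if for every vertex $v\in V(G)$: (1) $N[v]\cap S\neq\emptyset$, and (2) $\bigcap_{c\in N[v]\cap S}N[c]=\{v\}$; $\gamma^{\mathrm{SID}}(G)$ is the minimum size of such a code. With $V(K_m)=\{v_0,\dots,v_{m-1}\}$ and $V(P_n)=\{0,\dots,n-1\}$ (consecutively numbered path), the direct product $K_m\times P_n$ has vertices $(v_i,j)$, with $(v_i,j)$ adjacent to $(v_{i'},j')$ iff $i\neq i'$ and $|j-j'|=1$. -}

module Defs where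

open import Data.Nat using (ℕ; _≤_)
open import Data.Fin using (Fin; toℕ)
open import Data.Product using (_×_; _,_; ∃-syntax; Σ-syntax)
open import Data.List using (List; length)
open import Data.List.Membership.Propositional using (_∈_)
open import Data.List.Relation.Unary.Unique.Propositional using (Unique)
open import Relation.Binary.PropositionalEquality using (_≡_; _≢_)
open import Data.Sum using (_⊎_)

record Graph (V : Set) : Set₁ where
  field
    Adj : V → V → Set

open Graph public

-- closed neighbourhood: u ∈ N[v]  iff  u ≡ v or u adjacent to v
InClosedNbhd : {V : Set} → Graph V → V → V → Set
InClosedNbhd G u v = (u ≡ v) ⊎ Adj G v u

-- A code is a duplicate-free list of vertices; its size is its length.
-- S is self-identifying iff S is nonempty and for every vertex v:
--  (1) N[v] ∩ S ≠ ∅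
--  (2) ⋂_{c ∈ N[v] ∩ S} N[c] = {v}
IsSIDCode : {V : Set} → Graph V → List V → Set
IsSIDCode {V} G S =
  Unique S ×
  (∃[ c ] (c ∈ S)) ×
  ((v : V) →
    (∃[ c ] (c ∈ S × InClosedNbhd G c v)) ×
    ((u : V) →
      ((∀ c → c ∈ S → InClosedNbhd G c v → InClosedNbhd G u c)) → u ≡ v) ×
    (∀ c → c ∈ S → InClosedNbhd G c v → InClosedNbhd G v c))

SIDNumberIs : {V : Set} → Graph V → ℕ → Set
SIDNumberIs {V} G k =
  (Σ[ S ∈ List V ] (IsSIDCode G S × length S ≡ k)) ×
  ((S : List V) → IsSIDCode G S → k ≤ length S)

AdjPath : ℕ → ℕ → Set
AdjPath a b = (Data.Nat.suc a ≡ b) ⊎ (Data.Nat.suc b ≡ a)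

KxP : (m n : ℕ) → Graph (Fin m × Fin n)
KxP m n = record { Adj = λ { (i , j) (i' , j') → (i ≢ i') × AdjPath (toℕ j) (toℕ j') } }

-- Write (i , j) for the vertex of K_m × P_n in column i and layer j. If (i , 0) were not in a
-- code, every code vertex of N[(i , 0)] would lie on layer 1 in another column and hence be
-- adjacent to (i , 2) as well, so (i , 2) would not be separated from (i , 0): the end layers
-- lie in every code. Separating (x , 0) from (y , 1), x ≠ y, needs a code vertex (t , 1) with
-- t ∉ {x , y}, so a layer next to an end layer carries at least three code vertices. Counting
-- gives 2m + 3 for n = 3 (both end layers share their neighbour) and 2m + 6 for n = 4, and the
-- end layers together with three vertices on every inner layer attain these bounds.
module Submission where

open import Defs
open import Data.Nat using (ℕ; suc; _≤_; _+_; _*_; s≤s; z≤n)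
import Data.Nat as ℕ
open import Data.Nat.Properties using (1+n≢n)
open import Data.Nat.ListAction using (sum)
open import Data.Nat.Tactic.RingSolver using (solve-∀)
open import Data.Fin using (Fin; toℕ) renaming (zero to fz; suc to fs)
open import Data.Fin.Properties using (_≟_)
open import Data.Product using (_×_; _,_; proj₁; proj₂; ∃-syntax; Σ-syntax)
open import Data.Product.Properties using (≡-dec)
open import Data.Sum using (inj₁; inj₂; swap)
open import Data.Empty using (⊥-elim)
open import Data.List using (List; []; _∷_; length; map; concat; tabulate; allFin)
open import Data.List.Properties using (length-++; length-map; length-tabulate; map-tabulate; tabulate-cong)
open import Data.List.Membership.Propositional using (_∈_; find; lose)
open import Data.List.Membership.Propositional.Properties
  using (∈-map⁺; ∈-map⁻; ∈-concat⁺′; ∈-concat⁻′; ∈-tabulate⁺; ∈-tabulate⁻; ∈-allFin)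
open import Data.List.Relation.Binary.Subset.Propositional using (_⊆_)
open import Data.List.Relation.Unary.Any using (here; there; any?)
open import Data.List.Relation.Unary.All as All using (All; []; _∷_)
import Data.List.Relation.Unary.All.Properties as Allₚ
open import Data.List.Relation.Unary.AllPairs using ([]; _∷_)
import Data.List.Relation.Unary.AllPairs.Properties as AllPairs
open import Data.List.Relation.Unary.Unique.Propositional using (Unique)
open import Data.List.Relation.Unary.Unique.Propositional.Properties using (map⁺; concat⁺; allFin⁺)
open import Data.List.Fresh as List# using (fromList)
import Data.List.Fresh.Relation.Unary.Any as Any#
import Data.List.Fresh.Membership.Setoid as Membership#
import Data.List.Fresh.Membership.Setoid.Properties as Membership#ₚ
open import Function using (_∘_; id)
open import Relation.Binary.Definitions using (DecidableEquality)
open import Relation.Binary.PropositionalEquality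
open import Relation.Nullary using (¬_; Dec; yes; no)
open import Relation.Nullary.Decidable using (¬?; _×-dec_; _⊎-dec_; decidable-stable)

pattern F0 = fz
pattern F1 = fs fz
pattern F2 = fs (fs fz)
pattern F3 = fs (fs (fs fz))

module _ {A : Set} where
  open Membership# (setoid A) renaming (_∈_ to _∈#_)

  length-fromList : ∀ {xs : List A} (u : Unique xs) → List#.length (fromList u) ≡ length xs
  length-fromList [] = refl
  length-fromList (_ ∷ u) = cong suc (length-fromList u)

  ∈-fromList⁻ : ∀ {x} {xs : List A} (u : Unique xs) → x ∈# fromList u → x ∈ xs
  ∈-fromList⁻ (_ ∷ u) (Any#.here x≡) = here x≡
  ∈-fromList⁻ (_ ∷ u) (Any#.there x∈) = there (∈-fromList⁻ u x∈)

  ∈-fromList⁺ : ∀ {x} {xs : List A} (u : Unique xs) → x ∈ xs → x ∈# fromList u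
  ∈-fromList⁺ (_ ∷ u) (here x≡) = Any#.here x≡
  ∈-fromList⁺ (_ ∷ u) (there x∈) = Any#.there (∈-fromList⁺ u x∈)

  unique-⊆⇒length≤ : ∀ {xs ys : List A} → Unique xs → Unique ys → xs ⊆ ys → length xs ≤ length ys
  unique-⊆⇒length≤ uxs uys xs⊆ys =
    subst₂ _≤_ (length-fromList uxs) (length-fromList uys)
      (Membership#ₚ.injection (setoid A) id (∈-fromList⁺ uys ∘ xs⊆ys ∘ ∈-fromList⁻ uxs))

  Escapes : (A → Set) → Set
  Escapes P = ∀ {x y} → x ≢ y → ∃[ t ] P t × t ≢ x × t ≢ y

  ThreeDistinct : (A → Set) → Set
  ThreeDistinct P = Σ[ ts ∈ List A ] length ts ≡ 3 × Unique ts × All P ts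

  three-distinct : ∀ {P : A → Set} {x₀ y₀} → Escapes P → x₀ ≢ y₀ → ThreeDistinct P
  three-distinct escapes x₀≢y₀ with escapes x₀≢y₀
  ... | a , Pa , a≢x₀ , _ with escapes a≢x₀
  ... | b , Pb , b≢a , _ with escapes b≢a
  ... | c , Pc , c≢b , c≢a =
    (a ∷ b ∷ c ∷ []) , refl ,
    (≢-sym b≢a ∷ ≢-sym c≢a ∷ []) ∷ (≢-sym c≢b ∷ []) ∷ [] ∷ [] ,
    Pa ∷ Pb ∷ Pc ∷ []

length-concat : ∀ {A : Set} (xss : List (List A)) → length (concat xss) ≡ sum (map length xss)
length-concat [] = refl
length-concat (xs ∷ xss) = trans (length-++ xs) (cong (length xs +_) (length-concat xss))

module _ {V : Set} (G : Graph V) where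

  Separates : List V → V → V → Set
  Separates S v u = ∃[ c ] c ∈ S × InClosedNbhd G c v × ¬ InClosedNbhd G u c

  Identified : List V → V → Set
  Identified S v = (∃[ c ] c ∈ S × InClosedNbhd G c v) × (∀ u → u ≢ v → Separates S v u)

  separates : (∀ u v → Dec (InClosedNbhd G u v)) → ∀ {S} → IsSIDCode G S →
              ∀ {u v} → u ≢ v → Separates S v u
  separates _∈N?_ {S} (_ , _ , sid) {u} {v} u≢v
    with any? (λ c → (c ∈N? v) ×-dec ¬? (u ∈N? c)) S
  ... | yes separated = find separated
  ... | no ¬separated = ⊥-elim (u≢v (proj₁ (proj₂ (sid v)) u inEveryNeighbourhood))
    where
    inEveryNeighbourhood : ∀ c → c ∈ S → InClosedNbhd G c v → InClosedNbhd G u c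
    inEveryNeighbourhood c c∈S c∈N[v] =
      decidable-stable (u ∈N? c) (λ u∉N[c] → ¬separated (lose c∈S (c∈N[v] , u∉N[c])))

  isSIDCode : DecidableEquality V → (∀ {u v} → InClosedNbhd G u v → InClosedNbhd G v u) →
              ∀ {S} → Unique S → ∃[ c ] c ∈ S → (∀ v → Identified S v) → IsSIDCode G S
  isSIDCode _≟ᵥ_ N-sym {S} unique nonempty identified =
    unique , nonempty , λ v → proj₁ (identified v) , identifies v , λ _ _ → N-sym
    where
    identifies : ∀ v u → (∀ c → c ∈ S → InClosedNbhd G c v → InClosedNbhd G u c) → u ≡ v
    identifies v u inEveryNeighbourhood with u ≟ᵥ v
    ... | yes u≡v = u≡v
    ... | no u≢v with proj₂ (identified v) u u≢v
    ...   | c , c∈S , c∈N[v] , u∉N[c] = ⊥-elim (u∉N[c] (inEveryNeighbourhood c c∈S c∈N[v]))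

AdjPath-irrefl : ∀ a → ¬ AdjPath a a
AdjPath-irrefl a (inj₁ e) = 1+n≢n e
AdjPath-irrefl a (inj₂ e) = 1+n≢n e

AdjPath-sym : ∀ {a b} → AdjPath a b → AdjPath b a
AdjPath-sym = swap

adjPath? : ∀ a b → Dec (AdjPath a b)
adjPath? a b = (suc a ℕ.≟ b) ⊎-dec (suc b ℕ.≟ a)

module _ {n : ℕ} where

  Leaf : Fin n → Fin n → Set
  Leaf j₀ j₁ = AdjPath (toℕ j₀) (toℕ j₁) × (∀ l → AdjPath (toℕ j₀) (toℕ l) → l ≡ j₁)

  Leaf⇒≢ : ∀ {j₀ j₁} → Leaf j₀ j₁ → j₀ ≢ j₁
  Leaf⇒≢ (adj , _) refl = AdjPath-irrefl _ adj

leaf-first : ∀ {n} → Leaf {suc (suc n)} F0 F1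
leaf-first = inj₁ refl , λ where
  F0 (inj₁ ())
  F0 (inj₂ ())
  F1 _ → refl
  (fs (fs _)) (inj₁ ())
  (fs (fs _)) (inj₂ ())

leaf-last₃ : Leaf {3} F2 F1
leaf-last₃ = inj₂ refl , λ where
  F0 (inj₁ ())
  F0 (inj₂ ())
  F1 _ → refl
  F2 (inj₁ ())
  F2 (inj₂ ())

leaf-last₄ : Leaf {4} F3 F2
leaf-last₄ = inj₂ refl , λ where
  F0 (inj₁ ())
  F0 (inj₂ ())
  F1 (inj₁ ())
  F1 (inj₂ ())
  F2 _ → refl
  F3 (inj₁ ())
  F3 (inj₂ ())

module _ {m n : ℕ} where

  _∈N[_] : Fin m × Fin n → Fin m × Fin n → Set
  c ∈N[ v ] = InClosedNbhd (KxP m n) c v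

  _∈N?_ : ∀ c v → Dec (c ∈N[ v ])
  (i , j) ∈N? (i′ , j′) =
    ≡-dec _≟_ _≟_ (i , j) (i′ , j′) ⊎-dec (¬? (i′ ≟ i) ×-dec adjPath? (toℕ j′) (toℕ j))

  N-sym : ∀ {u v} → u ∈N[ v ] → v ∈N[ u ]
  N-sym (inj₁ u≡v) = inj₁ (sym u≡v)
  N-sym (inj₂ (i≢x , adj)) = inj₂ (≢-sym i≢x , AdjPath-sym adj)

  ¬N-sameLayer : ∀ {x t j} → x ≢ t → ¬ (x , j) ∈N[ (t , j) ]
  ¬N-sameLayer x≢t (inj₁ e) = x≢t (cong proj₁ e)
  ¬N-sameLayer _ (inj₂ (_ , adj)) = AdjPath-irrefl _ adj

  ¬N-sameColumn : ∀ {x j l} → j ≢ l → ¬ (x , j) ∈N[ (x , l) ]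
  ¬N-sameColumn j≢l (inj₁ e) = j≢l (cong proj₂ e)
  ¬N-sameColumn _ (inj₂ (x≢x , _)) = x≢x refl

  leafLayer⊆code : ∀ {S j₀ j₁ j₂} → IsSIDCode (KxP m n) S → Leaf j₀ j₁ →
                   AdjPath (toℕ j₁) (toℕ j₂) → j₂ ≢ j₀ → ∀ i → (i , j₀) ∈ S
  leafLayer⊆code {j₂ = j₂} sid (_ , only) adj₁₂ j₂≢j₀ i
    with separates (KxP m n) _∈N?_ sid {u = i , j₂} (j₂≢j₀ ∘ cong proj₂)
  ... | _ , c∈S , inj₁ refl , _ = c∈S
  ... | (x , l) , _ , inj₂ (i≢x , adj) , u∉N[c] with only l adj
  ...   | refl = ⊥-elim (u∉N[c] (inj₂ (≢-sym i≢x , adj₁₂)))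

  nextToLeaf-escapes : ∀ {S j₀ j₁} → IsSIDCode (KxP m n) S → Leaf j₀ j₁ →
                       Escapes (λ t → (t , j₁) ∈ S)
  nextToLeaf-escapes {j₀ = j₀} {j₁} sid leaf@(adj , only) {x} {y} x≢y
    with separates (KxP m n) _∈N?_ sid {u = y , j₁} {v = x , j₀} (Leaf⇒≢ leaf ∘ sym ∘ cong proj₂)
  ... | _ , _ , inj₁ refl , u∉N[c] = ⊥-elim (u∉N[c] (inj₂ (x≢y , adj)))
  ... | (t , l) , t∈S , inj₂ (x≢t , adj′) , u∉N[c] with only l adj′
  ...   | refl = t , t∈S , ≢-sym x≢t , λ t≡y → u∉N[c] (inj₁ (cong (_, j₁) (sym t≡y)))

  leaf-identified : ∀ {S j₀ j₁ i} → Leaf j₀ j₁ → (∀ t → (t , j₀) ∈ S) →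
                    Escapes (λ t → (t , j₁) ∈ S) → Identified (KxP m n) S (i , j₀)
  leaf-identified {S} {j₀} {j₁} {i} (adj , only) leafLayer⊆S escapes =
    ((i , j₀) , leafLayer⊆S i , inj₁ refl) , separated
    where
    separated : ∀ u → u ≢ (i , j₀) → Separates (KxP m n) S (i , j₀) u
    separated (x , j) u≢v with (x , j) ∈N? (i , j₀)
    ... | no u∉N[v] = (i , j₀) , leafLayer⊆S i , inj₁ refl , u∉N[v]
    ... | yes (inj₁ u≡v) = ⊥-elim (u≢v u≡v)
    ... | yes (inj₂ (i≢x , adj′)) with only j adj′
    ...   | refl with escapes i≢x
    ...     | t , t∈S , t≢i , t≢x =
      (t , j₁) , t∈S , inj₂ (≢-sym t≢i , adj) , ¬N-sameLayer (≢-sym t≢x)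

  nextToLeaf-identified : ∀ {S j₀ j₁ i} → Leaf j₀ j₁ → (∀ t → (t , j₀) ∈ S) →
                          (∀ x y → ∃[ t ] t ≢ x × t ≢ y) → Identified (KxP m n) S (i , j₁)
  nextToLeaf-identified {S} {j₀} {j₁} {i} leaf@(adj , only) leafLayer⊆S avoid =
    dominated , separated
    where
    neighbour : ∀ {t} → t ≢ i → (t , j₀) ∈N[ (i , j₁) ]
    neighbour t≢i = inj₂ (≢-sym t≢i , AdjPath-sym adj)

    dominated : ∃[ c ] c ∈ S × c ∈N[ (i , j₁) ]
    dominated with avoid i i
    ... | t , t≢i , _ = (t , j₀) , leafLayer⊆S t , neighbour t≢i

    separated : ∀ u → u ≢ (i , j₁) → Separates (KxP m n) S (i , j₁) u
    separated (x , j) u≢v with j ≟ j₀ | j ≟ j₁ | avoid i x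
    ... | yes refl | _ | t , t≢i , t≢x =
      (t , j₀) , leafLayer⊆S t , neighbour t≢i , ¬N-sameLayer (≢-sym t≢x)
    ... | no _ | yes refl | _ =
      (x , j₀) , leafLayer⊆S x , neighbour (u≢v ∘ cong (_, j₁)) , ¬N-sameColumn (Leaf⇒≢ leaf ∘ sym)
    ... | no j≢j₀ | no j≢j₁ | t , t≢i , _ =
      (t , j₀) , leafLayer⊆S t , neighbour t≢i , λ where
        (inj₁ u≡c) → j≢j₀ (cong proj₂ u≡c)
        (inj₂ (_ , adj′)) → j≢j₁ (only j adj′)

  onLayer : Fin n → List (Fin m) → List (Fin m × Fin n)
  onLayer j = map (_, j)

  layered : (Fin n → List (Fin m)) → List (Fin m × Fin n)
  layered cols = concat (tabulate λ j → onLayer j (cols j))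

  ∈-layered⁺ : ∀ cols {i j} → i ∈ cols j → (i , j) ∈ layered cols
  ∈-layered⁺ cols {j = j} i∈ =
    ∈-concat⁺′ (∈-map⁺ (_, j) i∈) (∈-tabulate⁺ {f = λ l → onLayer l (cols l)} j)

  ∈-layered⁻ : ∀ cols {v} → v ∈ layered cols → proj₁ v ∈ cols (proj₂ v)
  ∈-layered⁻ cols v∈ with ∈-concat⁻′ (tabulate λ j → onLayer j (cols j)) v∈
  ... | _ , v∈layer , layer∈ with ∈-tabulate⁻ layer∈
  ...   | _ , refl with ∈-map⁻ _ v∈layer
  ...     | _ , i∈ , refl = i∈

  layered-unique : ∀ cols → (∀ j → Unique (cols j)) → Unique (layered cols)
  layered-unique _ unique =
    concat⁺ (Allₚ.tabulate⁺ (map⁺ (cong proj₁) ∘ unique)) (AllPairs.tabulate⁺ disjoint)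
    where
    disjoint : ∀ {j l xs ys} → j ≢ l → ∀ {v} → ¬ (v ∈ onLayer j xs × v ∈ onLayer l ys)
    disjoint j≢l (v∈ , v∈′) with ∈-map⁻ _ v∈ | ∈-map⁻ _ v∈′
    ... | _ , _ , refl | _ , _ , refl = j≢l refl

  length-layered : ∀ cols → length (layered cols) ≡ sum (tabulate λ j → length (cols j))
  length-layered cols = begin
    length (layered cols)                             ≡⟨ length-concat layers ⟩
    sum (map length layers)                           ≡⟨ cong sum (map-tabulate (λ j → onLayer j (cols j)) length) ⟩
    sum (tabulate λ j → length (onLayer j (cols j)))  ≡⟨ cong sum (tabulate-cong λ j → length-map _ (cols j)) ⟩
    sum (tabulate λ j → length (cols j))              ∎
    where
    open ≡-Reasoning
    layers : List (List (Fin m × Fin n))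
    layers = tabulate λ j → onLayer j (cols j)

length-allFin : ∀ m → length (allFin m) ≡ m
length-allFin m = length-tabulate id

module _ {m : ℕ} where

  cols₃ : List (Fin m) → Fin 3 → List (Fin m)
  cols₃ ts F0 = allFin m
  cols₃ ts F1 = ts
  cols₃ ts F2 = allFin m

  cols₄ : List (Fin m) → List (Fin m) → Fin 4 → List (Fin m)
  cols₄ ts ts′ F0 = allFin m
  cols₄ ts ts′ F1 = ts
  cols₄ ts ts′ F2 = ts′
  cols₄ ts ts′ F3 = allFin m

  code₃ : List (Fin m) → List (Fin m × Fin 3)
  code₃ ts = layered (cols₃ ts)

  code₄ : List (Fin m) → List (Fin m) → List (Fin m × Fin 4)
  code₄ ts ts′ = layered (cols₄ ts ts′)

  code₃-unique : ∀ {ts} → Unique ts → Unique (code₃ ts)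
  code₃-unique {ts} uts = layered-unique (cols₃ ts) λ where
    F0 → allFin⁺ m
    F1 → uts
    F2 → allFin⁺ m

  code₄-unique : ∀ {ts ts′} → Unique ts → Unique ts′ → Unique (code₄ ts ts′)
  code₄-unique {ts} {ts′} uts uts′ = layered-unique (cols₄ ts ts′) λ where
    F0 → allFin⁺ m
    F1 → uts
    F2 → uts′
    F3 → allFin⁺ m

  length-code₃ : ∀ {ts : List (Fin m)} → length ts ≡ 3 → length (code₃ ts) ≡ 2 * m + 3
  length-code₃ {ts} |ts|≡3 = begin
    length (code₃ ts)                                          ≡⟨ length-layered (cols₃ ts) ⟩
    length (allFin m) + (length ts + (length (allFin m) + 0))
      ≡⟨ cong₂ (λ a b → a + (b + (a + 0))) (length-allFin m) |ts|≡3 ⟩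
    m + (3 + (m + 0))                                          ≡⟨ arith m ⟩
    2 * m + 3                                                  ∎
    where
    open ≡-Reasoning
    arith : ∀ m → m + (3 + (m + 0)) ≡ 2 * m + 3
    arith = solve-∀

  length-code₄ : ∀ {ts ts′} → length ts ≡ 3 → length ts′ ≡ 3 → length (code₄ ts ts′) ≡ 2 * m + 6
  length-code₄ {ts} {ts′} |ts|≡3 |ts′|≡3 = begin
    length (code₄ ts ts′)                                         ≡⟨ length-layered (cols₄ ts ts′) ⟩
    length (allFin m) + (length ts + (length ts′ + (length (allFin m) + 0)))
      ≡⟨ cong₂ (λ a b → a + (b + (length ts′ + (a + 0)))) (length-allFin m) |ts|≡3 ⟩
    m + (3 + (length ts′ + (m + 0)))
      ≡⟨ cong (λ c → m + (3 + (c + (m + 0)))) |ts′|≡3 ⟩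
    m + (3 + (3 + (m + 0)))                                       ≡⟨ arith m ⟩
    2 * m + 6                                                     ∎
    where
    open ≡-Reasoning
    arith : ∀ m → m + (3 + (3 + (m + 0))) ≡ 2 * m + 6
    arith = solve-∀

  sidCode₃-length≥ : ∀ {S} {x₀ y₀ : Fin m} → x₀ ≢ y₀ → IsSIDCode (KxP m 3) S → 2 * m + 3 ≤ length S
  sidCode₃-length≥ {S} x₀≢y₀ sid = count (three-distinct (nextToLeaf-escapes sid leaf-first) x₀≢y₀)
    where
    count : ThreeDistinct (λ t → (t , F1) ∈ S) → 2 * m + 3 ≤ length S
    count (ts , |ts|≡3 , uts , ts⊆S) =
      subst (_≤ length S) (length-code₃ {ts} |ts|≡3)
        (unique-⊆⇒length≤ (code₃-unique {ts} uts) (proj₁ sid) code⊆S)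
      where
      code⊆S : code₃ ts ⊆ S
      code⊆S {i , F0} _ = leafLayer⊆code sid leaf-first (inj₁ refl) (λ ()) i
      code⊆S {i , F1} v∈ = All.lookup ts⊆S (∈-layered⁻ (cols₃ ts) v∈)
      code⊆S {i , F2} _ = leafLayer⊆code sid leaf-last₃ (inj₂ refl) (λ ()) i

  sidCode₄-length≥ : ∀ {S} {x₀ y₀ : Fin m} → x₀ ≢ y₀ → IsSIDCode (KxP m 4) S → 2 * m + 6 ≤ length S
  sidCode₄-length≥ {S} x₀≢y₀ sid =
    count (three-distinct (nextToLeaf-escapes sid leaf-first) x₀≢y₀)
          (three-distinct (nextToLeaf-escapes sid leaf-last₄) x₀≢y₀)
    where
    count : ThreeDistinct (λ t → (t , F1) ∈ S) → ThreeDistinct (λ t → (t , F2) ∈ S) →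
            2 * m + 6 ≤ length S
    count (ts , |ts|≡3 , uts , ts⊆S) (ts′ , |ts′|≡3 , uts′ , ts′⊆S) =
      subst (_≤ length S) (length-code₄ {ts} {ts′} |ts|≡3 |ts′|≡3)
        (unique-⊆⇒length≤ (code₄-unique {ts} {ts′} uts uts′) (proj₁ sid) code⊆S)
      where
      code⊆S : code₄ ts ts′ ⊆ S
      code⊆S {i , F0} _ = leafLayer⊆code sid leaf-first (inj₁ refl) (λ ()) i
      code⊆S {i , F1} v∈ = All.lookup ts⊆S (∈-layered⁻ (cols₄ ts ts′) v∈)
      code⊆S {i , F2} v∈ = All.lookup ts′⊆S (∈-layered⁻ (cols₄ ts ts′) v∈)
      code⊆S {i , F3} _ = leafLayer⊆code sid leaf-last₄ (inj₂ refl) (λ ()) i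

module _ {k : ℕ} where

  first3 : List (Fin (3 + k))
  first3 = F0 ∷ F1 ∷ F2 ∷ []

  first3-unique : Unique first3
  first3-unique = ((λ ()) ∷ (λ ()) ∷ []) ∷ ((λ ()) ∷ []) ∷ [] ∷ []

  first3-avoids : ∀ x y → ∃[ t ] t ∈ first3 × t ≢ x × t ≢ y
  first3-avoids F0 F0 = F1 , there (here refl) , (λ ()) , (λ ())
  first3-avoids F0 F1 = F2 , there (there (here refl)) , (λ ()) , (λ ())
  first3-avoids F0 (fs (fs _)) = F1 , there (here refl) , (λ ()) , (λ ())
  first3-avoids F1 F0 = F2 , there (there (here refl)) , (λ ()) , (λ ())
  first3-avoids F1 F1 = F0 , here refl , (λ ()) , (λ ())
  first3-avoids F1 (fs (fs _)) = F0 , here refl , (λ ()) , (λ ())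
  first3-avoids (fs (fs _)) F0 = F1 , there (here refl) , (λ ()) , (λ ())
  first3-avoids (fs (fs _)) F1 = F0 , here refl , (λ ()) , (λ ())
  first3-avoids (fs (fs _)) (fs (fs _)) = F0 , here refl , (λ ()) , (λ ())

  avoid : ∀ x y → ∃[ t ] t ≢ x × t ≢ y
  avoid x y with first3-avoids x y
  ... | t , _ , t≢x , t≢y = t , t≢x , t≢y

  escapes-in : ∀ {n} {S : List (Fin (3 + k) × Fin n)} {j} →
               (∀ {t} → t ∈ first3 → (t , j) ∈ S) → Escapes (λ t → (t , j) ∈ S)
  escapes-in first3⊆S {x} {y} _ with first3-avoids x y
  ... | t , t∈ , t≢x , t≢y = t , first3⊆S t∈ , t≢x , t≢y

  code₃-isSIDCode : IsSIDCode (KxP (3 + k) 3) (code₃ first3)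
  code₃-isSIDCode =
    isSIDCode _ (≡-dec _≟_ _≟_) N-sym (code₃-unique first3-unique) ((F0 , F0) , full refl F0) λ where
      (i , F0) → leaf-identified leaf-first (full refl) (escapes-in (∈-layered⁺ cols))
      (i , F1) → nextToLeaf-identified leaf-first (full refl) avoid
      (i , F2) → leaf-identified leaf-last₃ (full refl) (escapes-in (∈-layered⁺ cols))
    where
    cols : Fin 3 → List (Fin (3 + k))
    cols = cols₃ first3
    full : ∀ {j} → cols j ≡ allFin (3 + k) → ∀ t → (t , j) ∈ code₃ first3
    full eq t = ∈-layered⁺ cols (subst (t ∈_) (sym eq) (∈-allFin t))

  code₄-isSIDCode : IsSIDCode (KxP (3 + k) 4) (code₄ first3 first3)
  code₄-isSIDCode =
    isSIDCode _ (≡-dec _≟_ _≟_) N-sym (code₄-unique first3-unique first3-unique)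
      ((F0 , F0) , full refl F0) λ where
      (i , F0) → leaf-identified leaf-first (full refl) (escapes-in (∈-layered⁺ cols))
      (i , F1) → nextToLeaf-identified leaf-first (full refl) avoid
      (i , F2) → nextToLeaf-identified leaf-last₄ (full refl) avoid
      (i , F3) → leaf-identified leaf-last₄ (full refl) (escapes-in (∈-layered⁺ cols))
    where
    cols : Fin 4 → List (Fin (3 + k))
    cols = cols₄ first3 first3
    full : ∀ {j} → cols j ≡ allFin (3 + k) → ∀ t → (t , j) ∈ code₄ first3 first3
    full eq t = ∈-layered⁺ cols (subst (t ∈_) (sym eq) (∈-allFin t))

  sidNumber₃ : SIDNumberIs (KxP (3 + k) 3) (2 * (3 + k) + 3)
  sidNumber₃ =
    (code₃ first3 , code₃-isSIDCode , length-code₃ {ts = first3} refl) ,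
    λ _ → sidCode₃-length≥ {x₀ = F0} {F1} (λ ())

  sidNumber₄ : SIDNumberIs (KxP (3 + k) 4) (2 * (3 + k) + 6)
  sidNumber₄ =
    (code₄ first3 first3 , code₄-isSIDCode , length-code₄ {ts = first3} {first3} refl refl) ,
    λ _ → sidCode₄-length≥ {x₀ = F0} {F1} (λ ())

theoremA2 : (m : ℕ) → 4 ≤ m →
    SIDNumberIs (KxP m 3) (2 * m + 3) × SIDNumberIs (KxP m 4) (2 * m + 6)
theoremA2 (suc (suc (suc (suc k)))) (s≤s (s≤s (s≤s (s≤s z≤n)))) = sidNumber₃ , sidNumber₄
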